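{- Let $(G,w)$ be an undirected vertex-weighted graph of maximum degree at most $3$, with $w:V(G)\to\mathbb{N}$, and let vertices $a,b,c$ form a triangle in $G$. If $(G,w)$ contains a path of weight $k$ and length $d$, then $(G/abc,w/abc)$ contains a path of weight at least $k$ and length at most $d$. Moreover, if $(G/abc,w/abc)$ contains a path of weight $k$, then $(G,w)$ contains a path of weight $k$.
   Context: All paths are simple. The weight of a path is the sum of the weights of its vertices, and its length is its number of vertices. $G/abc$ denotes the graph obtained from $G$ by contracting $a,b,c$ into a single new vertex $t$ (adjacent to every vertex outside $\{a,b,c\}$ that was adjacent to one of $a,b,c$), without creating multiple edges or loops. $w/abc:V(G/abc)\to\mathbb{N}$ is given by $w/abc(x)=w(x)$ for $x\neq t$ and $w/abc(t)=w(a)+w(b)+w(c)$. -}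

module Defs where

open import Data.Nat using (ℕ; _+_; _≤_)
open import Data.Fin using (Fin; _≟_)
open import Data.Bool using (Bool; true; false; not; _∨_; T)
open import Data.Maybe using (Maybe; just; nothing)
open import Data.Product using (Σ; _×_; _,_; proj₁)
open import Data.Sum using (_⊎_; inj₁; inj₂)
open import Data.Empty using (⊥)
open import Data.List using (List; []; _∷_; length; filter; map)
open import Data.Nat.ListAction using (sum)
open import Data.List.Relation.Unary.Unique.Propositional using (Unique)
open import Data.List.Relation.Unary.Linked using (Linked)
open import Relation.Binary.Core using (Rel)
open import Relation.Binary.Definitions using (Decidable)
open import Relation.Nullary using (¬_)
open import Relation.Nullary.Decidable using (⌊_⌋)
open import Data.List.Base using () renaming (allFin to allFinL)

record SimpleGraph (V : Set) : Set₁ where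
  field
    Adj   : Rel V _
    sym   : ∀ {x y} → Adj x y → Adj y x
    irrefl : ∀ {x} → ¬ Adj x x
open SimpleGraph public

degree : ∀ {n} (G : SimpleGraph (Fin n)) → Decidable (Adj G) → Fin n → ℕ
degree {n} G dec v = length (filter (dec v) (allFinL n))

MaxDegreeAtMost3 : ∀ {n} (G : SimpleGraph (Fin n)) → Decidable (Adj G) → Set
MaxDegreeAtMost3 G dec = ∀ v → degree G dec v ≤ 3

-- A (simple) path: a nonempty list of pairwise distinct vertices,
-- consecutive vertices adjacent.  Its length is the number of vertices.
IsPath : ∀ {V} → SimpleGraph V → List V → Set
IsPath G p = 1 ≤ length p × Unique p × Linked (Adj G) p

weight : ∀ {V : Set} → (V → ℕ) → List V → ℕ
weight w p = sum (map w p)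

inABC : ∀ {n} → Fin n → Fin n → Fin n → Fin n → Bool
inABC a b c x = ⌊ x ≟ a ⌋ ∨ ⌊ x ≟ b ⌋ ∨ ⌊ x ≟ c ⌋

-- vertices of G/abc: nothing = the new vertex t, just x for x ∉ {a,b,c}
CV : ∀ {n} → Fin n → Fin n → Fin n → Set
CV {n} a b c = Maybe (Σ (Fin n) λ x → T (not (inABC a b c x)))

CAdj : ∀ {n} (G : SimpleGraph (Fin n)) (a b c : Fin n) → Rel (CV a b c) _
CAdj G a b c nothing  nothing  = ⊥
CAdj G a b c nothing  (just (y , _)) = Adj G a y ⊎ Adj G b y ⊎ Adj G c y
CAdj G a b c (just (x , _)) nothing  = Adj G x a ⊎ Adj G x b ⊎ Adj G x c
CAdj G a b c (just (x , _)) (just (y , _)) = Adj G x y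

CAdj-sym : ∀ {n} (G : SimpleGraph (Fin n)) (a b c : Fin n) {x y} →
           CAdj G a b c x y → CAdj G a b c y x
CAdj-sym G a b c {nothing} {just _} (inj₁ e) = inj₁ (sym G e)
CAdj-sym G a b c {nothing} {just _} (inj₂ (inj₁ e)) = inj₂ (inj₁ (sym G e))
CAdj-sym G a b c {nothing} {just _} (inj₂ (inj₂ e)) = inj₂ (inj₂ (sym G e))
CAdj-sym G a b c {just _} {nothing} (inj₁ e) = inj₁ (sym G e)
CAdj-sym G a b c {just _} {nothing} (inj₂ (inj₁ e)) = inj₂ (inj₁ (sym G e))
CAdj-sym G a b c {just _} {nothing} (inj₂ (inj₂ e)) = inj₂ (inj₂ (sym G e))
CAdj-sym G a b c {just _} {just _} e = sym G e

CAdj-irrefl : ∀ {n} (G : SimpleGraph (Fin n)) (a b c : Fin n) {x} →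
              ¬ CAdj G a b c x x
CAdj-irrefl G a b c {nothing} ()
CAdj-irrefl G a b c {just _} e = irrefl G e

contract : ∀ {n} (G : SimpleGraph (Fin n)) (a b c : Fin n) → SimpleGraph (CV a b c)
contract G a b c = record
  { Adj = CAdj G a b c ; sym = λ {x} {y} → CAdj-sym G a b c {x} {y} ; irrefl = λ {x} → CAdj-irrefl G a b c {x} }

contractW : ∀ {n} (w : Fin n → ℕ) (a b c : Fin n) → CV a b c → ℕ
contractW w a b c nothing = w a + w b + w c
contractW w a b c (just (x , _)) = w x

-- A triangle vertex has its two other triangle vertices as neighbours, so with maximum
-- degree 3 it has at most one neighbour outside the triangle. Consequently no triangle
-- vertex of a simple path lies between two outside vertices, and a simple path meets the
-- triangle at most three times; these two facts force every such path meeting the triangle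
-- into the shape C₁ X B Y C₂ with B ≠ [], where B, C₁, C₂ consist of triangle vertices and
-- X, Y avoid the triangle. Contracting B to t and dropping C₁ and C₂ leaves the path X t Y
-- of G/abc: it keeps every outside vertex of the path, t outweighs the triangle vertices
-- it replaces, and it is no longer.
-- Conversely, in a path X t Y of G/abc the neighbours of t attach to two different triangle
-- vertices (again by the one-outside-neighbour property), so t can be expanded to the
-- whole triangle traversed between them, which preserves the weight exactly.

module Submission where

open import Defs hiding (sym)
open import Data.Bool using (Bool; true; false; not; T)
open import Data.Bool.Properties using (T-irrelevant)
open import Data.Empty using (⊥; ⊥-elim)
open import Data.Fin using (Fin; _≟_)
open import Data.List using (List; []; _∷_; _++_; length; map; filter; filterᵇ; head; last)
open import Data.List.Properties
  using (map-++; map-∘; length-map; ++-identityʳ; ++-assoc; filter-reject; filter-all; filter-none; filter-++;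
         length-++-≤ʳ)
open import Data.List.Membership.Propositional using (_∈_)
open import Data.List.Membership.Propositional.Properties using (∈-∃++; ∈-filter⁺; ∈-filter⁻; ∈-allFin)
open import Data.List.Relation.Binary.Disjoint.Propositional using (Disjoint)
open import Data.List.Relation.Binary.Permutation.Propositional
  using (_↭_; ↭-refl; ↭-prep; ↭-swap; ↭-trans; ↭-sym; ↭-reflexive; ↭⇒↭ₛ)
open import Data.List.Relation.Binary.Permutation.Propositional.Properties using (shift; shifts; map⁺; ∈-resp-↭)
import Data.List.Relation.Binary.Permutation.Setoid.Properties as ↭ₛ
open import Data.List.Relation.Binary.Subset.Propositional using (_⊆_)
open import Data.List.Relation.Unary.All as All using (All; []; _∷_)
import Data.List.Relation.Unary.All.Properties as All
open import Data.List.Relation.Unary.AllPairs using ([]; _∷_)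
open import Data.List.Relation.Unary.Any using (here; there)
open import Data.List.Relation.Unary.Linked as Linked using (Linked; []; [-]; _∷_)
import Data.List.Relation.Unary.Linked.Properties as Linked
open import Data.List.Relation.Unary.Unique.Propositional using (Unique)
import Data.List.Relation.Unary.Unique.Propositional.Properties as Unique
open import Data.Maybe using (Maybe; just; nothing)
open import Data.Maybe.Properties using (just-injective)
open import Data.Nat using (ℕ; suc; _+_; _≤_; z≤n; s≤s)
open import Data.Nat.ListAction using (sum)
open import Data.Nat.ListAction.Properties using (sum-++; sum-↭)
open import Data.Nat.Properties
  using (≤-refl; ≤-trans; ≤-reflexive; n≤1+n; +-monoʳ-≤; +-mono-≤; +-assoc; +-identityʳ; +-commutativeSemigroup;
         module ≤-Reasoning)
open import Algebra.Properties.CommutativeSemigroup +-commutativeSemigroup using (x∙yz≈y∙xz)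
open import Data.Product using (Σ; ∃; ∃₂; _×_; _,_; proj₁; proj₂)
open import Data.Sum using (_⊎_; inj₁; inj₂)
open import Data.Unit using (⊤; tt)
open import Function using (_∘_; const)
open import Relation.Nullary using (¬_)
open import Relation.Nullary.Decidable using (T?; yes; no)
open import Relation.Unary using (∁)
import Relation.Unary as U
open import Relation.Binary.Definitions using (Decidable)
import Relation.Binary.PropositionalEquality as ≡
open import Relation.Binary.PropositionalEquality
  using (_≡_; _≢_; ≢-sym; refl; sym; trans; cong; subst; module ≡-Reasoning)

module _ {A : Set} where

  open ↭ₛ (≡.setoid A) using (Unique-resp-↭)

  weight-++ : ∀ (f : A → ℕ) xs ys → weight f (xs ++ ys) ≡ weight f xs + weight f ys
  weight-++ f xs ys = trans (cong sum (map-++ f xs ys)) (sum-++ (map f xs) (map f ys))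

  weight-↭ : ∀ (f : A → ℕ) {xs ys} → xs ↭ ys → weight f xs ≡ weight f ys
  weight-↭ f = sum-↭ ∘ map⁺ f

  unique-↭ : ∀ {xs ys : List A} → xs ↭ ys → Unique xs → Unique ys
  unique-↭ = Unique-resp-↭ ∘ ↭⇒↭ₛ

  weight-mono-⊆ : ∀ (f : A → ℕ) {xs ys} → Unique xs → xs ⊆ ys → weight f xs ≤ weight f ys
  weight-mono-⊆ f {[]} _ _ = z≤n
  weight-mono-⊆ f {x ∷ xs} (x∉xs ∷ xs!) xs⊆ys with ∈-∃++ (xs⊆ys (here refl))
  ... | L₁ , L₂ , refl = begin
    f x + weight f xs          ≤⟨ +-monoʳ-≤ (f x) (weight-mono-⊆ f xs! xs⊆L₁L₂) ⟩
    f x + weight f (L₁ ++ L₂)  ≡⟨ weight-↭ f (↭-sym (shift x L₁ L₂)) ⟩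
    weight f (L₁ ++ x ∷ L₂)    ∎
    where
    open ≤-Reasoning
    xs⊆L₁L₂ : xs ⊆ L₁ ++ L₂
    xs⊆L₁L₂ y∈xs with ∈-resp-↭ (shift x L₁ L₂) (xs⊆ys (there y∈xs))
    ... | here refl = ⊥-elim (All.lookup x∉xs y∈xs refl)
    ... | there y∈L = y∈L

  length≡weight-1 : ∀ (xs : List A) → length xs ≡ weight (const 1) xs
  length≡weight-1 []       = refl
  length≡weight-1 (x ∷ xs) = cong suc (length≡weight-1 xs)

  length-mono-⊆ : ∀ {xs ys : List A} → Unique xs → xs ⊆ ys → length xs ≤ length ys
  length-mono-⊆ {xs} {ys} xs! xs⊆ys rewrite length≡weight-1 xs | length≡weight-1 ys =
    weight-mono-⊆ (const 1) xs! xs⊆ys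

  weight-filterᵇ-split : ∀ (f : A → ℕ) (p : A → Bool) xs →
                         weight f xs ≡ weight f (filterᵇ p xs) + weight f (filterᵇ (not ∘ p) xs)
  weight-filterᵇ-split f p [] = refl
  weight-filterᵇ-split f p (x ∷ xs) with p x
  ... | true  = trans (cong (f x +_) (weight-filterᵇ-split f p xs)) (sym (+-assoc (f x) _ _))
  ... | false = trans (cong (f x +_) (weight-filterᵇ-split f p xs))
                      (x∙yz≈y∙xz (f x) (weight f (filterᵇ p xs)) (weight f (filterᵇ (not ∘ p) xs)))

  length-filterᵇ-split : ∀ (p : A → Bool) xs →
                         length xs ≡ length (filterᵇ p xs) + length (filterᵇ (not ∘ p) xs)
  length-filterᵇ-split p xs
    rewrite length≡weight-1 xs | length≡weight-1 (filterᵇ p xs) | length≡weight-1 (filterᵇ (not ∘ p) xs)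
    = weight-filterᵇ-split (const 1) p xs

  length-filterᵇ-∷ : ∀ (p : A → Bool) x xs → length (filterᵇ p xs) ≤ length (filterᵇ p (x ∷ xs))
  length-filterᵇ-∷ p x xs with p x
  ... | true  = n≤1+n _
  ... | false = ≤-refl

  module _ {P : A → Set} (P? : U.Decidable P) where

    filter-++-all : ∀ {xs} ys → All P xs → filter P? (xs ++ ys) ≡ xs ++ filter P? ys
    filter-++-all {xs} ys Pxs = trans (filter-++ P? xs ys) (cong (_++ _) (filter-all P? Pxs))

    filter-++-none : ∀ {xs} ys → All (∁ P) xs → filter P? (xs ++ ys) ≡ filter P? ys
    filter-++-none {xs} ys ¬Pxs = trans (filter-++ P? xs ys) (cong (_++ _) (filter-none P? ¬Pxs))

module _ {A : Set} {R : A → A → Set} where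

  Linked-++⁻ˡ : ∀ xs {ys} → Linked R (xs ++ ys) → Linked R xs
  Linked-++⁻ˡ []           _          = []
  Linked-++⁻ˡ (x ∷ [])     _          = [-]
  Linked-++⁻ˡ (x ∷ y ∷ xs) (Rxy ∷ Rs) = Rxy ∷ Linked-++⁻ˡ (y ∷ xs) Rs

  Linked-++⁻ʳ : ∀ xs {ys} → Linked R (xs ++ ys) → Linked R ys
  Linked-++⁻ʳ []       Rs = Rs
  Linked-++⁻ʳ (x ∷ xs) Rs = Linked-++⁻ʳ xs (Linked.tail Rs)

  Linked-glue : ∀ xs {v ys} → Linked R (xs ++ v ∷ []) → Linked R (v ∷ ys) → Linked R (xs ++ v ∷ ys)
  Linked-glue []           _          Rvys = Rvys
  Linked-glue (x ∷ [])     (Rxv ∷ _)  Rvys = Rxv ∷ Rvys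
  Linked-glue (x ∷ y ∷ xs) (Rxy ∷ Rs) Rvys = Rxy ∷ Linked-glue (y ∷ xs) Rs Rvys

module _ {B : Set} where

  all-just : ∀ (q : List (Maybe B)) → All (nothing ≢_) q → ∃ λ Q → q ≡ map just Q
  all-just []           []           = [] , refl
  all-just (nothing ∷ q) (n≢n ∷ _)   = ⊥-elim (n≢n refl)
  all-just (just x ∷ q) (_ ∷ n∉q) with all-just q n∉q
  ... | Q , refl = x ∷ Q , refl

  split-at-nothing : ∀ (q : List (Maybe B)) → Unique q →
                     (∃ λ Q → q ≡ map just Q) ⊎
                     (∃₂ λ X Y → q ≡ map just X ++ nothing ∷ map just Y)
  split-at-nothing []           _          = inj₁ ([] , refl)
  split-at-nothing (nothing ∷ q) (n∉q ∷ _) with all-just q n∉q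
  ... | Y , refl = inj₂ ([] , Y , refl)
  split-at-nothing (just x ∷ q) (_ ∷ q!) with split-at-nothing q q!
  ... | inj₁ (Q , refl)     = inj₁ (x ∷ Q , refl)
  ... | inj₂ (X , Y , refl) = inj₂ (x ∷ X , Y , refl)

module Runs {A : Set} (inside : A → Bool) where

  In Out : A → Set
  In x  = T (inside x)
  Out x = T (not (inside x))

  Outside : Set
  Outside = Σ A Out

  classify : ∀ x → In x ⊎ Out x
  classify x with inside x
  ... | true  = inj₁ _
  ... | false = inj₂ _

  Out⇒¬In : ∀ {x} → Out x → ¬ In x
  Out⇒¬In {x} with inside x
  ... | true  = λ ()
  ... | false = λ _ ()

  In≢Out : ∀ {x y} → In x → Out y → x ≢ y
  In≢Out {x} ix oy refl = Out⇒¬In {x} oy ix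

  inside-outside-disjoint : ∀ {xs} → All In xs → (Z : List Outside) → Disjoint xs (map proj₁ Z)
  inside-outside-disjoint ixs Z (v∈xs , v∈Z) =
    Out⇒¬In (All.lookup (All.fromList Z) v∈Z) (All.lookup ixs v∈xs)

  outside-injective : ∀ {x y : Outside} → proj₁ x ≡ proj₁ y → x ≡ y
  outside-injective {x , ox} {.x , oy} refl = cong (x ,_) (T-irrelevant ox oy)

  NoSandwich : List A → Set
  NoSandwich (x ∷ v ∷ y ∷ zs) = (Out x → In v → Out y → ⊥) × NoSandwich (v ∷ y ∷ zs)
  NoSandwich _                = ⊤

  NoSandwich-tail : ∀ {x xs} → NoSandwich (x ∷ xs) → NoSandwich xs
  NoSandwich-tail {xs = []}        _  = tt
  NoSandwich-tail {xs = _ ∷ []}    _  = tt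
  NoSandwich-tail {xs = _ ∷ _ ∷ _} ns = proj₂ ns

  -- b ∷ B is the block that is contracted; the end blocks C₁ and C₂ are dropped.
  record CoreSplit (xs : List A) : Set where
    constructor coreSplit
    field
      C₁ : List A
      X  : List Outside
      b  : A
      B  : List A
      Y  : List Outside
      C₂ : List A
      C₁-in : All In C₁
      b-in  : In b
      B-in  : All In B
      C₂-in : All In C₂
      xs≡   : xs ≡ C₁ ++ map proj₁ X ++ b ∷ B ++ map proj₁ Y ++ C₂

  In? : U.Decidable In
  In? = T? ∘ inside

  Out? : U.Decidable Out
  Out? = T? ∘ (not ∘ inside)

  outside-¬In : ∀ (X : List Outside) → All (∁ In) (map proj₁ X)
  outside-¬In X = All.map Out⇒¬In (All.fromList X)

  inside-¬Out : ∀ {C} → All In C → All (∁ Out) C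
  inside-¬Out = All.map (λ ix ox → Out⇒¬In ox ix)

  filter-In-core : ∀ {xs} (s : CoreSplit xs) → let open CoreSplit s in filter In? xs ≡ C₁ ++ b ∷ B ++ C₂
  filter-In-core (coreSplit C₁ X b B Y C₂ C₁-in b-in B-in C₂-in refl) = begin
    filter In? (C₁ ++ map proj₁ X ++ b ∷ B ++ map proj₁ Y ++ C₂)
      ≡⟨ filter-++-all In? _ C₁-in ⟩
    C₁ ++ filter In? (map proj₁ X ++ b ∷ B ++ map proj₁ Y ++ C₂)
      ≡⟨ cong (C₁ ++_) (filter-++-none In? _ (outside-¬In X)) ⟩
    C₁ ++ filter In? (b ∷ B ++ map proj₁ Y ++ C₂)
      ≡⟨ cong (C₁ ++_) (filter-++-all In? _ (b-in ∷ B-in)) ⟩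
    C₁ ++ b ∷ B ++ filter In? (map proj₁ Y ++ C₂)
      ≡⟨ cong (λ t → C₁ ++ b ∷ B ++ t) (filter-++-none In? _ (outside-¬In Y)) ⟩
    C₁ ++ b ∷ B ++ filter In? C₂
      ≡⟨ cong (λ t → C₁ ++ b ∷ B ++ t) (filter-all In? C₂-in) ⟩
    C₁ ++ b ∷ B ++ C₂ ∎
    where open ≡-Reasoning

  filter-Out-core : ∀ {xs} (s : CoreSplit xs) → let open CoreSplit s in filter Out? xs ≡ map proj₁ (X ++ Y)
  filter-Out-core (coreSplit C₁ X b B Y C₂ C₁-in b-in B-in C₂-in refl) = begin
    filter Out? (C₁ ++ map proj₁ X ++ b ∷ B ++ map proj₁ Y ++ C₂)
      ≡⟨ filter-++-none Out? _ (inside-¬Out C₁-in) ⟩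
    filter Out? (map proj₁ X ++ b ∷ B ++ map proj₁ Y ++ C₂)
      ≡⟨ filter-++-all Out? _ (All.fromList X) ⟩
    map proj₁ X ++ filter Out? (b ∷ B ++ map proj₁ Y ++ C₂)
      ≡⟨ cong (map proj₁ X ++_) (filter-++-none Out? _ (inside-¬Out (b-in ∷ B-in))) ⟩
    map proj₁ X ++ filter Out? (map proj₁ Y ++ C₂)
      ≡⟨ cong (map proj₁ X ++_) (filter-++-all Out? _ (All.fromList Y)) ⟩
    map proj₁ X ++ map proj₁ Y ++ filter Out? C₂
      ≡⟨ cong (λ t → map proj₁ X ++ map proj₁ Y ++ t) (filter-none Out? (inside-¬Out C₂-in)) ⟩
    map proj₁ X ++ map proj₁ Y ++ []
      ≡⟨ cong (map proj₁ X ++_) (++-identityʳ (map proj₁ Y)) ⟩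
    map proj₁ X ++ map proj₁ Y
      ≡⟨ map-++ proj₁ X Y ⟨
    map proj₁ (X ++ Y) ∎
    where open ≡-Reasoning

  NoSandwich-++⁻ʳ : ∀ xs {ys} → NoSandwich (xs ++ ys) → NoSandwich ys
  NoSandwich-++⁻ʳ []       ns = ns
  NoSandwich-++⁻ʳ (x ∷ xs) ns = NoSandwich-++⁻ʳ xs (NoSandwich-tail ns)

  flanked-¬In : ∀ (x : Outside) X {v} (y : Outside) {R} →
                NoSandwich (map proj₁ (x ∷ X) ++ v ∷ proj₁ y ∷ R) → ¬ In v
  flanked-¬In (_ , ox) []       (_ , oy) ns iv = proj₁ ns ox iv oy
  flanked-¬In _        (x ∷ X) y         ns    = flanked-¬In x X y (NoSandwich-tail ns)

  private
    two-≤-length : ∀ (C₁ : List A) {b} B {z} C₂ → 2 ≤ length (C₁ ++ b ∷ B ++ z ∷ C₂)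
    two-≤-length C₁ {b} B {z} C₂ =
      ≤-trans (s≤s (≤-trans (s≤s z≤n) (length-++-≤ʳ (z ∷ C₂) {B})))
              (length-++-≤ʳ (b ∷ B ++ z ∷ C₂) {C₁})

    too-many-inside : ∀ {x xs} → Out x → (s : CoreSplit xs) → let open CoreSplit s in
                      4 ≤ length (C₁ ++ b ∷ B ++ C₂) → length (filter In? (x ∷ xs)) ≤ 3 → ⊥
    too-many-inside ox s 4≤ cnt with ≤-trans 4≤ (subst (_≤ 3) (cong length count≡) cnt)
      where count≡ = trans (filter-reject In? (Out⇒¬In ox)) (filter-In-core s)
    ... | s≤s (s≤s (s≤s ()))

  coreSplit-or-outside : ∀ xs → NoSandwich xs → length (filter In? xs) ≤ 3 →
                         (∃ λ (N : List Outside) → xs ≡ map proj₁ N) ⊎ CoreSplit xs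
  coreSplit-or-outside []       _  _   = inj₁ ([] , refl)
  coreSplit-or-outside (x ∷ xs) ns cnt
    with classify x | coreSplit-or-outside xs (NoSandwich-tail ns) (≤-trans (length-filterᵇ-∷ inside x xs) cnt)
  ... | inj₁ ix | inj₁ (N , refl) =
    inj₂ (coreSplit [] [] x [] N [] [] ix [] [] (cong (x ∷_) (sym (++-identityʳ _))))
  ... | inj₁ ix | inj₂ (coreSplit C₁ X b B Y C₂ c₁ ib iB c₂ refl) =
    inj₂ (coreSplit (x ∷ C₁) X b B Y C₂ (ix ∷ c₁) ib iB c₂ refl)
  ... | inj₂ ox | inj₁ (N , refl) = inj₁ ((x , ox) ∷ N , refl)
  ... | inj₂ ox | inj₂ (coreSplit [] X b B Y C₂ _ ib iB c₂ refl) =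
    inj₂ (coreSplit [] ((x , ox) ∷ X) b B Y C₂ [] ib iB c₂ refl)
  ... | inj₂ ox | inj₂ (coreSplit (c ∷ C₁) [] b B Y C₂ (ic ∷ c₁) ib iB c₂ refl) =
    inj₂ (coreSplit [] ((x , ox) ∷ []) c (C₁ ++ b ∷ B) Y C₂ [] ic (All.++⁺ c₁ (ib ∷ iB)) c₂
                    (cong (λ t → x ∷ c ∷ t) (sym (++-assoc C₁ (b ∷ B) (map proj₁ Y ++ C₂)))))
  ... | inj₂ ox | inj₂ (coreSplit (c ∷ []) ((y , oy) ∷ X) b B Y C₂ (ic ∷ _) _ _ _ refl) =
    ⊥-elim (proj₁ ns ox ic oy)
  -- From here on C₁ becomes the core and b ∷ B the dropped end block; Y and C₂ must be empty,
  -- as otherwise there are four inside elements or b is flanked by X and Y.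
  ... | inj₂ ox | inj₂ (coreSplit (c ∷ c′ ∷ C₁) (y ∷ X) b B [] [] (ic ∷ ic′ ∷ c₁) ib iB _ refl) =
    inj₂ (coreSplit [] ((x , ox) ∷ []) c (c′ ∷ C₁) (y ∷ X) (b ∷ B) [] ic (ic′ ∷ c₁) (ib ∷ iB)
                    (cong (λ t → x ∷ c ∷ c′ ∷ C₁ ++ proj₁ y ∷ map proj₁ X ++ b ∷ t) (++-identityʳ B)))
  ... | inj₂ ox | inj₂ s@(coreSplit (c ∷ c′ ∷ C₁) (y ∷ X) b B Y (z ∷ C₂) _ _ _ _ refl) =
    ⊥-elim (too-many-inside ox s (s≤s (s≤s (two-≤-length C₁ B C₂))) cnt)
  ... | inj₂ ox | inj₂ (coreSplit (c ∷ c′ ∷ C₁) (y ∷ X) b [] (z ∷ Y) [] _ ib _ _ refl) =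
    ⊥-elim (flanked-¬In y X z (NoSandwich-++⁻ʳ (x ∷ c ∷ c′ ∷ C₁) ns) ib)
  ... | inj₂ ox | inj₂ s@(coreSplit (c ∷ c′ ∷ C₁) (y ∷ X) b (b′ ∷ B) (z ∷ Y) [] _ _ _ _ refl) =
    ⊥-elim (too-many-inside ox s (s≤s (s≤s (two-≤-length C₁ [] (B ++ [])))) cnt)

module Triangle {n} (G : SimpleGraph (Fin n)) (dec : Decidable (Adj G)) (deg : MaxDegreeAtMost3 G dec)
                (a b c : Fin n) (ab : Adj G a b) (bc : Adj G b c) (ca : Adj G c a) where

  open Runs (inABC a b c)

  G/abc : SimpleGraph (CV a b c)
  G/abc = contract G a b c

  abc : List (Fin n)
  abc = a ∷ b ∷ c ∷ []

  In⇒∈ : ∀ {x} → In x → x ∈ abc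
  In⇒∈ {x} ix with x ≟ a | x ≟ b | x ≟ c
  ... | yes x≡a | _       | _       = here x≡a
  ... | no _    | yes x≡b | _       = there (here x≡b)
  ... | no _    | no _    | yes x≡c = there (there (here x≡c))

  ∈⇒In : ∀ {x} → x ∈ abc → In x
  ∈⇒In {x} x∈abc with x ≟ a | x ≟ b | x ≟ c
  ... | yes _   | _       | _       = tt
  ... | no _    | yes _   | _       = tt
  ... | no _    | no _    | yes _   = tt
  ... | no x≢a  | no x≢b  | no x≢c  with x∈abc
  ...   | here x≡a                 = x≢a x≡a
  ...   | there (here x≡b)         = x≢b x≡b
  ...   | there (there (here x≡c)) = x≢c x≡c

  Adj⇒≢ : ∀ {x y} → Adj G x y → x ≢ y
  Adj⇒≢ xy refl = irrefl G xy

  abc-unique : Unique abc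
  abc-unique = (Adj⇒≢ ab ∷ ≢-sym (Adj⇒≢ ca) ∷ []) ∷ (Adj⇒≢ bc ∷ []) ∷ [] ∷ []

  Adj-sym : ∀ {x y} → Adj G x y → Adj G y x
  Adj-sym = SimpleGraph.sym G

  adj-within : ∀ {x y} → x ∈ abc → y ∈ abc → x ≢ y → Adj G x y
  adj-within (here refl)                 (here refl)                 x≢y = ⊥-elim (x≢y refl)
  adj-within (here refl)                 (there (here refl))         _   = ab
  adj-within (here refl)                 (there (there (here refl))) _   = Adj-sym ca
  adj-within (there (here refl))         (here refl)                 _   = Adj-sym ab
  adj-within (there (here refl))         (there (here refl))         x≢y = ⊥-elim (x≢y refl)
  adj-within (there (here refl))         (there (there (here refl))) _   = bc
  adj-within (there (there (here refl))) (here refl)                 _   = ca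
  adj-within (there (there (here refl))) (there (here refl))         _   = Adj-sym bc
  adj-within (there (there (here refl))) (there (there (here refl))) x≢y = ⊥-elim (x≢y refl)

  another : ∀ {x} → x ∈ abc → ∃ λ y → y ∈ abc × x ≢ y
  another (here refl)                 = b , there (here refl) , Adj⇒≢ ab
  another (there (here refl))         = c , there (there (here refl)) , Adj⇒≢ bc
  another (there (there (here refl))) = a , here refl , Adj⇒≢ ca

  acb↭abc : a ∷ c ∷ b ∷ [] ↭ abc
  acb↭abc = ↭-prep a (↭-swap c b ↭-refl)

  third : ∀ {x y} → x ∈ abc → y ∈ abc → x ≢ y → ∃ λ m → x ∷ m ∷ y ∷ [] ↭ abc
  third (here refl)                 (here refl)                 x≢y = ⊥-elim (x≢y refl)
  third (here refl)                 (there (here refl))         _   = c , acb↭abc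
  third (here refl)                 (there (there (here refl))) _   = b , ↭-refl
  third (there (here refl))         (here refl)                 _   = c , shift a (b ∷ c ∷ []) []
  third (there (here refl))         (there (here refl))         x≢y = ⊥-elim (x≢y refl)
  third (there (here refl))         (there (there (here refl))) _   = a , ↭-swap b a ↭-refl
  third (there (there (here refl))) (here refl)                 _   = b , ↭-trans (shift a (c ∷ b ∷ []) [])
                                                                                   acb↭abc
  third (there (there (here refl))) (there (here refl))         _   = a , ↭-trans (shift a (c ∷ []) (b ∷ []))
                                                                                   acb↭abc
  third (there (there (here refl))) (there (there (here refl))) x≢y = ⊥-elim (x≢y refl)

  neighbours≤degree : ∀ {u vs} → Unique vs → All (Adj G u) vs → length vs ≤ degree G dec u
  neighbours≤degree vs! u~vs =
    length-mono-⊆ vs! (λ v∈vs → ∈-filter⁺ (dec _) (∈-allFin _) (All.lookup u~vs v∈vs))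

  triangle-neighbours : ∀ {u} → u ∈ abc →
                        ∃₂ λ v v′ → v ∈ abc × v′ ∈ abc × v ≢ v′ × Adj G u v × Adj G u v′
  triangle-neighbours (here refl) =
    b , c , there (here refl) , there (there (here refl)) , Adj⇒≢ bc , ab , Adj-sym ca
  triangle-neighbours (there (here refl)) =
    c , a , there (there (here refl)) , here refl , Adj⇒≢ ca , bc , Adj-sym ab
  triangle-neighbours (there (there (here refl))) =
    a , b , here refl , there (here refl) , Adj⇒≢ ab , ca , Adj-sym bc

  no-four-neighbours : ∀ {u vs} → Unique vs → All (Adj G u) vs → 4 ≤ length vs → ⊥
  no-four-neighbours {u} vs! u~vs 4≤ with ≤-trans 4≤ (≤-trans (neighbours≤degree vs! u~vs) (deg u))
  ... | s≤s (s≤s (s≤s ()))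

  one-outside-neighbour : ∀ {u x y} → In u → Adj G u x → Adj G u y → Out x → Out y → x ≡ y
  one-outside-neighbour {u} {x} {y} iu ux uy ox oy with x ≟ y | triangle-neighbours (In⇒∈ iu)
  ... | yes x≡y | _ = x≡y
  ... | no x≢y  | v , v′ , v∈abc , v′∈abc , v≢v′ , uv , uv′ =
    ⊥-elim (no-four-neighbours four! (uv ∷ uv′ ∷ ux ∷ uy ∷ []) ≤-refl)
    where
    iv = ∈⇒In v∈abc
    iv′ = ∈⇒In v′∈abc
    four! : Unique (v ∷ v′ ∷ x ∷ y ∷ [])
    four! = (v≢v′ ∷ In≢Out iv ox ∷ In≢Out iv oy ∷ []) ∷ (In≢Out iv′ ox ∷ In≢Out iv′ oy ∷ [])
          ∷ (x≢y ∷ []) ∷ [] ∷ []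

  simple-noSandwich : ∀ {p} → Unique p → Linked (Adj G) p → NoSandwich p
  simple-noSandwich {[]}             _                    _                     = tt
  simple-noSandwich {_ ∷ []}         _                    _                     = tt
  simple-noSandwich {_ ∷ _ ∷ []}     _                    _                     = tt
  simple-noSandwich {x ∷ v ∷ y ∷ zs} ((_ ∷ x≢y ∷ _) ∷ p!) (xv ∷ p~@(vy ∷ _)) =
    (λ ox iv oy → x≢y (one-outside-neighbour iv (Adj-sym xv) vy ox oy)) , simple-noSandwich p! p~

  filter-In⊆abc : ∀ xs → filter In? xs ⊆ abc
  filter-In⊆abc xs v∈ = In⇒∈ (proj₂ (∈-filter⁻ In? {xs = xs} v∈))

  linked-just : ∀ {Q : List Outside} → Linked (Adj G) (map proj₁ Q) → Linked (Adj G/abc) (map just Q)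
  linked-just = Linked.map⁺ ∘ Linked.map⁻

  linked-proj₁ : ∀ {Q : List Outside} → Linked (Adj G/abc) (map just Q) → Linked (Adj G) (map proj₁ Q)
  linked-proj₁ = Linked.map⁺ ∘ Linked.map⁻

  unique-just : ∀ {Q : List Outside} → Unique (map proj₁ Q) → Unique (map just Q)
  unique-just = Unique.map⁺ just-injective ∘ Unique.map⁻

  unique-proj₁ : ∀ {Q : List Outside} → Unique (map just Q) → Unique (map proj₁ Q)
  unique-proj₁ = Unique.map⁺ outside-injective ∘ Unique.map⁻

  path-just : ∀ {Q : List Outside} → IsPath G (map proj₁ Q) → IsPath G/abc (map just Q)
  path-just {Q} (len , Q! , Q~) =
    subst (1 ≤_) (trans (length-map proj₁ Q) (sym (length-map just Q))) len ,
    unique-just Q! , linked-just Q~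

  path-proj₁ : ∀ {Q : List Outside} → IsPath G/abc (map just Q) → IsPath G (map proj₁ Q)
  path-proj₁ {Q} (len , Q! , Q~) =
    subst (1 ≤_) (trans (length-map just Q) (sym (length-map proj₁ Q))) len ,
    unique-proj₁ Q! , linked-proj₁ Q~

  contracted : List Outside → List Outside → List (CV a b c)
  contracted X Y = map just X ++ nothing ∷ map just Y

  contracted-↭ : ∀ X Y → contracted X Y ↭ nothing ∷ map just (X ++ Y)
  contracted-↭ X Y =
    ↭-trans (shift nothing (map just X) (map just Y)) (↭-prep nothing (↭-reflexive (sym (map-++ just X Y))))

  length-contracted : ∀ X Y → length (contracted X Y) ≡ suc (length (X ++ Y))
  length-contracted []      Y = cong suc (length-map just Y)
  length-contracted (_ ∷ X) Y = cong suc (length-contracted X Y)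

  unique-contracted⁺ : ∀ X Y → Unique (map proj₁ (X ++ Y)) → Unique (contracted X Y)
  unique-contracted⁺ X Y XY! =
    unique-↭ (↭-sym (contracted-↭ X Y)) (All.map⁺ (All.universal (λ _ ()) (X ++ Y)) ∷ unique-just XY!)

  unique-contracted⁻ : ∀ X Y → Unique (contracted X Y) → Unique (map proj₁ (X ++ Y))
  unique-contracted⁻ X Y q! with unique-↭ (contracted-↭ X Y) q!
  ... | _ ∷ XY! = unique-proj₁ XY!

  adj-t⁺ : ∀ {x : Outside} {u} → u ∈ abc → Adj G (proj₁ x) u → Adj G/abc (just x) nothing
  adj-t⁺ (here refl)                 xu = inj₁ xu
  adj-t⁺ (there (here refl))         xu = inj₂ (inj₁ xu)
  adj-t⁺ (there (there (here refl))) xu = inj₂ (inj₂ xu)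

  collapse-left : ∀ X {u R} → In u → Linked (Adj G) (map proj₁ X ++ u ∷ R) →
                  Linked (Adj G/abc) (map just X ++ nothing ∷ [])
  collapse-left []          _  _           = [-]
  collapse-left (x ∷ [])    iu (xu ∷ _)    = adj-t⁺ {x} (In⇒∈ iu) xu ∷ [-]
  collapse-left (x ∷ y ∷ X) iu (xy ∷ p~)   = xy ∷ collapse-left (y ∷ X) iu p~

  collapse-right : ∀ {u} B Y {R} → In u → All In B → Linked (Adj G) (u ∷ B ++ map proj₁ Y ++ R) →
                   Linked (Adj G/abc) (nothing ∷ map just Y)
  collapse-right []      []      _  _          _          = [-]
  collapse-right []      (y ∷ Y) iu _          (uy ∷ p~)  =
    CAdj-sym G a b c {just y} {nothing} (adj-t⁺ {y} (In⇒∈ iu) (Adj-sym uy))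
    ∷ linked-just (Linked-++⁻ˡ (map proj₁ (y ∷ Y)) p~)
  collapse-right (v ∷ B) Y       _  (iv ∷ iB) (_ ∷ p~)   = collapse-right B Y iv iB p~

  -- Conditions on the last vertex of X and the first vertex of Y in a path X t Y of G/abc;
  -- nothing stands for an empty side.
  Touch : Maybe Outside → Set
  Touch nothing  = ⊤
  Touch (just x) = ∃ λ l → l ∈ abc × Adj G (proj₁ x) l

  Attach : Maybe Outside → Fin n → Set
  Attach nothing  _ = ⊤
  Attach (just x) l = Adj G (proj₁ x) l

  Apart : Maybe Outside → Maybe Outside → Set
  Apart (just x) (just y) = proj₁ x ≢ proj₁ y
  Apart _        _        = ⊤

  adj-t⁻ : ∀ {x : Outside} → Adj G/abc (just x) nothing → Touch (just x)
  adj-t⁻ (inj₁ xa)        = a , here refl , xa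
  adj-t⁻ (inj₂ (inj₁ xb)) = b , there (here refl) , xb
  adj-t⁻ (inj₂ (inj₂ xc)) = c , there (there (here refl)) , xc

  Ordering : Maybe Outside → Maybe Outside → Set
  Ordering mx my = ∃₂ λ l m → ∃ λ r → (l ∷ m ∷ r ∷ [] ↭ abc) × Attach mx l × Attach my r

  ordered : ∀ mx my {l r} → l ∈ abc → r ∈ abc → l ≢ r → Attach mx l → Attach my r → Ordering mx my
  ordered _ _ l∈abc r∈abc l≢r xl yr with third l∈abc r∈abc l≢r
  ... | m , lmr↭abc = _ , m , _ , lmr↭abc , xl , yr

  ordering : ∀ mx my → Touch mx → Touch my → Apart mx my → Ordering mx my
  ordering (just x) (just y) (l , l∈abc , xl) (r , r∈abc , yr) x≢y with l ≟ r
  ... | no l≢r   = ordered (just x) (just y) l∈abc r∈abc l≢r xl yr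
  ... | yes refl =
    ⊥-elim (x≢y (one-outside-neighbour (∈⇒In l∈abc) (Adj-sym xl) (Adj-sym yr) (proj₂ x) (proj₂ y)))
  ordering (just x) nothing  (l , l∈abc , xl) _ _ with another l∈abc
  ... | r , r∈abc , l≢r = ordered (just x) nothing l∈abc r∈abc l≢r xl tt
  ordering nothing  (just y) _ (r , r∈abc , yr) _ with another r∈abc
  ... | l , l∈abc , r≢l = ordered nothing (just y) l∈abc r∈abc (≢-sym r≢l) tt yr
  ordering nothing  nothing  _ _ _ = a , b , c , ↭-refl , tt , tt

  touch-left : ∀ X {R} → Linked (Adj G/abc) (map just X ++ nothing ∷ R) → Touch (last X)
  touch-left []          _         = tt
  touch-left (x ∷ [])    (xt ∷ _)  = adj-t⁻ {x} xt
  touch-left (x ∷ y ∷ X) (_ ∷ q~)  = touch-left (y ∷ X) q~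

  touch-right : ∀ Y → Linked (Adj G/abc) (nothing ∷ map just Y) → Touch (head Y)
  touch-right []      _        = tt
  touch-right (y ∷ Y) (ty ∷ _) = adj-t⁻ {y} (CAdj-sym G a b c {nothing} {just y} ty)

  attach-left : ∀ X {R l} → Linked (Adj G/abc) (map just X ++ nothing ∷ R) → Attach (last X) l →
                Linked (Adj G) (map proj₁ X ++ l ∷ [])
  attach-left []          _        _  = [-]
  attach-left (x ∷ [])    _        xl = xl ∷ [-]
  attach-left (x ∷ y ∷ X) (xy ∷ q~) yl = xy ∷ attach-left (y ∷ X) q~ yl

  attach-right : ∀ Y {r} → Linked (Adj G/abc) (nothing ∷ map just Y) → Attach (head Y) r →
                 Linked (Adj G) (r ∷ map proj₁ Y)
  attach-right []      _        _  = [-]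
  attach-right (y ∷ Y) (_ ∷ q~) yr = Adj-sym yr ∷ linked-proj₁ q~

  apart : ∀ X {Y} → Unique (contracted X Y) → Apart (last X) (head Y)
  apart []          _                          = tt
  apart (x ∷ [])    {[]}    _                  = tt
  apart (x ∷ [])    {y ∷ Y} ((_ ∷ x≢y ∷ _) ∷ _) = x≢y ∘ cong just ∘ outside-injective
  apart (x ∷ x′ ∷ X) (_ ∷ q!)                  = apart (x′ ∷ X) q!

  ordered-linked : ∀ {l m r} → l ∷ m ∷ r ∷ [] ↭ abc → Linked (Adj G) (l ∷ m ∷ r ∷ [])
  ordered-linked {l} {m} {r} lmr↭abc with unique-↭ (↭-sym lmr↭abc) abc-unique
  ... | (l≢m ∷ _) ∷ (m≢r ∷ []) ∷ _ =
    adj-within (∈abc (here refl)) (∈abc (there (here refl))) l≢m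
    ∷ adj-within (∈abc (there (here refl))) (∈abc (there (there (here refl)))) m≢r ∷ [-]
    where
    ∈abc : ∀ {v} → v ∈ l ∷ m ∷ r ∷ [] → v ∈ abc
    ∈abc = ∈-resp-↭ lmr↭abc

  expanded-↭ : ∀ (X Y : List Outside) {l m r} →
               map proj₁ X ++ l ∷ m ∷ r ∷ map proj₁ Y ↭ (l ∷ m ∷ r ∷ []) ++ map proj₁ (X ++ Y)
  expanded-↭ X Y {l} {m} {r} =
    ↭-trans (shifts (map proj₁ X) (l ∷ m ∷ r ∷ []))
            (↭-reflexive (cong (λ t → l ∷ m ∷ r ∷ t) (sym (map-++ proj₁ X Y))))

  module _ (w : Fin n → ℕ) where

    w/abc : CV a b c → ℕ
    w/abc = contractW w a b c

    weight-abc : weight w abc ≡ w/abc nothing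
    weight-abc = trans (cong (λ t → w a + (w b + t)) (+-identityʳ (w c))) (sym (+-assoc (w a) (w b) (w c)))

    weight-just : ∀ (Q : List Outside) → weight w/abc (map just Q) ≡ weight w (map proj₁ Q)
    -- both sides are sum (map (w ∘ proj₁) Q)
    weight-just Q = cong sum (trans (sym (map-∘ Q)) (map-∘ Q))

    weight-contracted : ∀ X Y → weight w/abc (contracted X Y) ≡ w/abc nothing + weight w (map proj₁ (X ++ Y))
    weight-contracted X Y =
      trans (weight-↭ w/abc (contracted-↭ X Y)) (cong (w/abc nothing +_) (weight-just (X ++ Y)))

    Contraction : List (Fin n) → Set
    Contraction p = ∃ λ q → IsPath G/abc q × weight w p ≤ weight w/abc q × length q ≤ length p

    contract-core : ∀ {p} → IsPath G p → CoreSplit p → Contraction p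
    contract-core {p} (_ , p! , p~) s@(coreSplit C₁ X u B Y C₂ _ iu iB _ refl) =
      contracted X Y , (len-q , q! , q~) , weight≤ , length≤
      where
      len-q : 1 ≤ length (contracted X Y)
      len-q = ≤-trans (s≤s z≤n) (length-++-≤ʳ (nothing ∷ map just Y) {map just X})
      q! : Unique (contracted X Y)
      q! = unique-contracted⁺ X Y (subst Unique (filter-Out-core s) (Unique.filter⁺ Out? p!))
      q~ : Linked (Adj G/abc) (contracted X Y)
      q~ = Linked-glue (map just X) (collapse-left X iu (Linked-++⁻ʳ C₁ p~))
             (collapse-right B Y iu iB (Linked-++⁻ʳ (map proj₁ X) (Linked-++⁻ʳ C₁ p~)))
      outside = map proj₁ (X ++ Y)
      weight≤ : weight w p ≤ weight w/abc (contracted X Y)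
      weight≤ = begin
        weight w p                                          ≡⟨ weight-filterᵇ-split w (inABC a b c) p ⟩
        weight w (filter In? p) + weight w (filter Out? p)  ≤⟨ +-mono-≤ inside≤ (≤-reflexive (cong (weight w) (filter-Out-core s))) ⟩
        weight w abc + weight w outside                     ≡⟨ cong (_+ weight w outside) weight-abc ⟩
        w/abc nothing + weight w outside                    ≡⟨ weight-contracted X Y ⟨
        weight w/abc (contracted X Y)                       ∎
        where
        open ≤-Reasoning
        inside≤ = weight-mono-⊆ w (Unique.filter⁺ In? p!) (filter-In⊆abc p)
      length≤ : length (contracted X Y) ≤ length p
      length≤ = begin
        length (contracted X Y)                         ≡⟨ length-contracted X Y ⟩
        1 + length (X ++ Y)                             ≡⟨ cong suc (length-map proj₁ (X ++ Y)) ⟨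
        1 + length outside                              ≤⟨ +-mono-≤ 1≤inside (≤-reflexive (cong length (sym (filter-Out-core s)))) ⟩
        length (filter In? p) + length (filter Out? p)  ≡⟨ length-filterᵇ-split (inABC a b c) p ⟨
        length p                                        ∎
        where
        open ≤-Reasoning
        1≤inside = subst (λ t → 1 ≤ length t) (sym (filter-In-core s))
                         (≤-trans (s≤s z≤n) (length-++-≤ʳ (u ∷ B ++ C₂) {C₁}))

    contract-path : ∀ {p} → IsPath G p → Contraction p
    contract-path {p} P@(_ , p! , p~)
      with coreSplit-or-outside p (simple-noSandwich p! p~)
                                  (length-mono-⊆ (Unique.filter⁺ In? p!) (filter-In⊆abc p))
    ... | inj₁ (N , refl) =
      map just N , path-just P , ≤-reflexive (sym (weight-just N)) ,
      ≤-reflexive (trans (length-map just N) (sym (length-map proj₁ N)))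
    ... | inj₂ s          = contract-core P s

    Expansion : List (CV a b c) → Set
    Expansion q = ∃ λ p → IsPath G p × weight w p ≡ weight w/abc q

    expand-core : ∀ X Y → IsPath G/abc (contracted X Y) → Expansion (contracted X Y)
    expand-core X Y (_ , q! , q~)
      with ordering (last X) (head Y) (touch-left X q~) (touch-right Y (Linked-++⁻ʳ (map just X) q~)) (apart X q!)
    ... | l , m , r , lmr↭abc , xl , ry = p , (len-p , p! , p~) , weight≡
      where
      p = map proj₁ X ++ l ∷ m ∷ r ∷ map proj₁ Y
      lmr! : Unique (l ∷ m ∷ r ∷ [])
      lmr! = unique-↭ (↭-sym lmr↭abc) abc-unique
      lmr-in : All In (l ∷ m ∷ r ∷ [])
      lmr-in = All.tabulate (∈⇒In ∘ ∈-resp-↭ lmr↭abc)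
      len-p : 1 ≤ length p
      len-p = ≤-trans (s≤s z≤n) (length-++-≤ʳ (l ∷ m ∷ r ∷ map proj₁ Y) {map proj₁ X})
      p! : Unique p
      p! = unique-↭ (↭-sym (expanded-↭ X Y))
             (Unique.++⁺ lmr! (unique-contracted⁻ X Y q!) (inside-outside-disjoint lmr-in (X ++ Y)))
      p~ : Linked (Adj G) p
      p~ = Linked-glue (map proj₁ X) (attach-left X q~ xl)
             (Linked-glue (l ∷ m ∷ []) (ordered-linked lmr↭abc)
                          (attach-right Y (Linked-++⁻ʳ (map just X) q~) ry))
      outside = map proj₁ (X ++ Y)
      weight≡ : weight w p ≡ weight w/abc (contracted X Y)
      weight≡ = begin
        weight w p                                   ≡⟨ weight-↭ w (expanded-↭ X Y) ⟩
        weight w ((l ∷ m ∷ r ∷ []) ++ outside)       ≡⟨ weight-++ w (l ∷ m ∷ r ∷ []) outside ⟩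
        weight w (l ∷ m ∷ r ∷ []) + weight w outside ≡⟨ cong (_+ weight w outside) (weight-↭ w lmr↭abc) ⟩
        weight w abc + weight w outside              ≡⟨ cong (_+ weight w outside) weight-abc ⟩
        w/abc nothing + weight w outside             ≡⟨ weight-contracted X Y ⟨
        weight w/abc (contracted X Y)                ∎
        where open ≡-Reasoning

    expand-path : ∀ {q} → IsPath G/abc q → Expansion q
    expand-path {q} Q@(_ , q! , _) with split-at-nothing q q!
    ... | inj₁ (N , refl)     = map proj₁ N , path-proj₁ Q , sym (weight-just N)
    ... | inj₂ (X , Y , refl) = expand-core X Y Q

lemma16 : (n : ℕ) (G : SimpleGraph (Fin n)) (dec : Decidable (Adj G))
            → MaxDegreeAtMost3 G dec
            → (w : Fin n → ℕ) (a b c : Fin n)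
            → Adj G a b → Adj G b c → Adj G c a
            → ((k d : ℕ)
                 → Σ (List (Fin n)) (λ p → IsPath G p × weight w p ≡ k × length p ≡ d)
                 → Σ (List (CV a b c)) (λ q → IsPath (contract G a b c) q
                       × k ≤ weight (contractW w a b c) q × length q ≤ d))
              × ((k : ℕ)
                 → Σ (List (CV a b c)) (λ q → IsPath (contract G a b c) q
                       × weight (contractW w a b c) q ≡ k)
                 → Σ (List (Fin n)) (λ p → IsPath G p × weight w p ≡ k))
lemma16 n G dec deg w a b c ab bc ca =
  (λ { _ _ (p , P , refl , refl) → contract-path w P }) ,
  (λ { _ (q , Q , refl) → expand-path w Q })
  where open Triangle G dec deg a b c ab bc ca
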